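{- Let $G$ be a bipartite graph with partite sets $A$ and $B$, $1\leq |A|\leq |B|$, such that $E(G)\neq\emptyset$. Then $\gamma(C(G))\leq |B|+1$, and equality holds only if $B\cap N^*(A)\neq\emptyset$.
   Context: All graphs are finite, undirected and simple. The central graph $C(G)$ is obtained from $G$ by subdividing each edge of $G$ exactly once and joining every pair of vertices non-adjacent in $G$ by an edge. $\gamma$ denotes the domination number. For $S\subseteq V(G)$, $N^*(S)=\{x\in V(G)\setminus S : S\subseteq N_G(x)\}$. -}

module Defs where

open import Data.Nat using (ℕ)
open import Data.Bool using (Bool; true; false)
open import Data.Fin using (Fin; _<_)
open import Data.Fin.Subset using (Subset; _∈_; _∉_)
open import Data.List using (List; length)
open import Data.List.Membership.Propositional using () renaming (_∈_ to _∈ₗ_)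
open import Data.List.Relation.Unary.Unique.Propositional using (Unique)
open import Data.Product using (Σ; ∃; _×_; _,_)
open import Data.Sum using (_⊎_)
open import Data.Empty using (⊥)
open import Relation.Binary.PropositionalEquality using (_≡_; _≢_)

record Graph (n : ℕ) : Set where
  field
    adj        : Fin n → Fin n → Bool
    adj-sym    : ∀ u v → adj u v ≡ adj v u
    adj-irrefl : ∀ v → adj v v ≡ false
open Graph public

Edge : ∀ {n} → Graph n → Fin n → Fin n → Set
Edge G u v = adj G u v ≡ true

Dominating : {V : Set} → (V → V → Set) → List V → Set
Dominating {V} R D = ∀ v → v ∈ₗ D ⊎ ∃ λ u → u ∈ₗ D × R u v

IsDominationNumber : {V : Set} → (V → V → Set) → ℕ → Set
IsDominationNumber {V} R k =
  (∃ λ (D : List V) → Unique D × Dominating R D × length D ≡ k)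
  × (∀ (D : List V) → Unique D → Dominating R D → k Data.Nat.≤ length D)

-- Central graph C(G): vertices of G plus one subdivision vertex per edge {i,j}
-- (represented as the pair (i , j) with i < j).
SubdivVertex : ∀ {n} → Graph n → Set
SubdivVertex {n} G = Σ (Fin n × Fin n) λ { (i , j) → i < j × Edge G i j }

CVertex : ∀ {n} → Graph n → Set
CVertex {n} G = Fin n ⊎ SubdivVertex G

CAdj : ∀ {n} (G : Graph n) → CVertex G → CVertex G → Set
CAdj G (_⊎_.inj₁ u) (_⊎_.inj₁ v) = u ≢ v × adj G u v ≡ false
CAdj G (_⊎_.inj₁ u) (_⊎_.inj₂ ((i , j) , _)) = u ≡ i ⊎ u ≡ j
CAdj G (_⊎_.inj₂ ((i , j) , _)) (_⊎_.inj₁ u) = u ≡ i ⊎ u ≡ j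
CAdj G (_⊎_.inj₂ _) (_⊎_.inj₂ _) = ⊥

-- A (as a subset) and its complement B are the partite sets: every edge joins A and B.
IsBipartition : ∀ {n} → Graph n → Subset n → Set
IsBipartition {n} G A =
  ∀ u v → Edge G u v → (u ∈ A × v ∉ A) ⊎ (u ∉ A × v ∈ A)

NStar : ∀ {n} → Graph n → Subset n → Fin n → Set
NStar {n} G S x = x ∉ S × (∀ y → y ∈ S → Edge G y x)

{-# OPTIONS --safe #-}

-- A set D of original vertices dominates C(G) as soon as it meets every edge of G (this
-- handles the subdivision vertices) and every vertex outside D has a non-neighbour in D
-- (these are adjacent in C(G)). For a bipartition (A, B) both B ∪ {a}, for any a ∈ A, and,
-- when no vertex of B is adjacent to all of A, the set A itself have these two properties;
-- the latter gives γ(C(G)) ≤ |A| ≤ |B|.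

module Submission where

open import Defs
open import Data.Nat using (ℕ; suc; _≤_; _<_)
open import Data.Nat.Properties using (≤-trans; ≤-reflexive; n≮n)
open import Data.Fin using (Fin; zero; suc; _≟_)
open import Data.Fin.Properties using (any?; all?; ¬∀⟶∃¬; suc-injective)
open import Data.Fin.Subset using (Subset; _∈_; _∉_; ∁; ∣_∣; inside; outside; Nonempty)
open import Data.Fin.Subset.Properties using (_∈?_; x∉p⇒x∈∁p; x∈∁p⇒x∉p; nonempty?; Empty-unique; ∣⊥∣≡0)
open import Data.Bool using (true; false)
open import Data.Bool.Properties using () renaming (_≟_ to _≟ᵇ_)
open import Data.Vec using ([]; _∷_)
import Data.Vec as Vec
open import Data.List using (List; length; map) renaming ([] to []ₗ; _∷_ to _∷ₗ_)
open import Data.List.Properties using (length-map)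
open import Data.List.Membership.Propositional using () renaming (_∈_ to _∈ₗ_; _∉_ to _∉ₗ_)
import Data.List.Membership.DecPropositional as DecMembership
open import Data.List.Membership.Propositional.Properties using (∈-map⁺; ∈-map⁻)
open import Data.List.Relation.Unary.Any using (here; there)
open import Data.List.Relation.Unary.All.Properties using (¬Any⇒All¬)
open import Data.List.Relation.Unary.AllPairs using ([]; _∷_)
open import Data.List.Relation.Unary.Unique.Propositional using (Unique)
open import Data.List.Relation.Unary.Unique.Propositional.Properties using (map⁺)
open import Data.Product using (∃; ∃₂; _×_; _,_)
open import Data.Sum using (_⊎_; inj₁; inj₂)
open import Data.Sum.Properties using (inj₁-injective)
open import Relation.Nullary using (¬_; Dec; yes; no; contradiction)
open import Relation.Nullary.Decidable using (¬?; _×-dec_; _→-dec_)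
open import Relation.Unary using (Decidable)
open import Relation.Binary.PropositionalEquality using (_≡_; refl; trans; cong; subst)

private
  variable
    n : ℕ

elements : Subset n → List (Fin n)
elements []            = []ₗ
elements (inside ∷ p)  = zero ∷ₗ map suc (elements p)
elements (outside ∷ p) = map suc (elements p)

length-elements : (p : Subset n) → length (elements p) ≡ ∣ p ∣
length-elements []            = refl
length-elements (inside ∷ p)  = cong suc (trans (length-map suc (elements p)) (length-elements p))
length-elements (outside ∷ p) = trans (length-map suc (elements p)) (length-elements p)

∈-elements⁺ : {p : Subset n} {x : Fin n} → x ∈ p → x ∈ₗ elements p
∈-elements⁺ {p = inside ∷ p}  Vec.here        = here refl
∈-elements⁺ {p = inside ∷ p}  (Vec.there x∈p) = there (∈-map⁺ suc (∈-elements⁺ x∈p))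
∈-elements⁺ {p = outside ∷ p} (Vec.there x∈p) = ∈-map⁺ suc (∈-elements⁺ x∈p)

∈-elements⁻ : (p : Subset n) {x : Fin n} → x ∈ₗ elements p → x ∈ p
∈-elements⁻ (inside ∷ p) (here refl) = Vec.here
∈-elements⁻ (inside ∷ p) (there x∈) with ∈-map⁻ suc x∈
... | y , y∈ , refl = Vec.there (∈-elements⁻ p y∈)
∈-elements⁻ (outside ∷ p) x∈ with ∈-map⁻ suc x∈
... | y , y∈ , refl = Vec.there (∈-elements⁻ p y∈)

zero∉map-suc : (xs : List (Fin n)) → zero ∉ₗ map suc xs
zero∉map-suc xs z∈ with ∈-map⁻ suc z∈
... | _ , _ , ()

elements-unique : (p : Subset n) → Unique (elements p)
elements-unique []            = []
elements-unique (inside ∷ p)  =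
  ¬Any⇒All¬ _ (zero∉map-suc (elements p)) ∷ map⁺ suc-injective (elements-unique p)
elements-unique (outside ∷ p) = map⁺ suc-injective (elements-unique p)

0<∣p∣⇒nonempty : (p : Subset n) → 0 < ∣ p ∣ → Nonempty p
0<∣p∣⇒nonempty {n} p 0<∣p∣ with nonempty? p
... | yes ne = ne
... | no  ¬ne = contradiction (subst (λ q → 0 < ∣ q ∣) (Empty-unique ¬ne) 0<∣p∣)
                              (λ 0<∣⊥∣ → n≮n 0 (≤-trans 0<∣⊥∣ (≤-reflexive (∣⊥∣≡0 n))))

module _ (G : Graph n) where

  open DecMembership (_≟_ {n}) using () renaming (_∈?_ to _∈ₗ?_)

  edge? : ∀ u v → Dec (Edge G u v)
  edge? u v = adj G u v ≟ᵇ true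

  ¬Edge⇒adj≡false : ∀ {u v} → ¬ Edge G u v → adj G u v ≡ false
  ¬Edge⇒adj≡false {u} {v} ¬e with adj G u v
  ... | true  = contradiction refl ¬e
  ... | false = refl

  NStar? : (S : Subset n) → Decidable (NStar G S)
  NStar? S x = ¬? (x ∈? S) ×-dec all? (λ y → (y ∈? S) →-dec edge? y x)

  VertexCover : List (Fin n) → Set
  VertexCover D = ∀ u v → Edge G u v → u ∈ₗ D ⊎ v ∈ₗ D

  DominatingInComplement : List (Fin n) → Set
  DominatingInComplement D = ∀ v → v ∉ₗ D → ∃ λ a → a ∈ₗ D × ¬ Edge G a v

  central-dominating : ∀ {D} → VertexCover D → DominatingInComplement D →
                       Dominating (CAdj G) (map inj₁ D)
  central-dominating {D} cover dom (inj₁ v) with v ∈ₗ? D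
  ... | yes v∈D = inj₁ (∈-map⁺ inj₁ v∈D)
  ... | no  v∉D = let a , a∈D , ¬e = dom v v∉D in
    inj₂ (inj₁ a , ∈-map⁺ inj₁ a∈D , (λ a≡v → v∉D (subst (_∈ₗ D) a≡v a∈D)) , ¬Edge⇒adj≡false ¬e)
  central-dominating cover dom (inj₂ ((i , j) , _ , e)) with cover i j e
  ... | inj₁ i∈D = inj₂ (inj₁ i , ∈-map⁺ inj₁ i∈D , inj₁ refl)
  ... | inj₂ j∈D = inj₂ (inj₁ j , ∈-map⁺ inj₁ j∈D , inj₂ refl)

  domination-number≤length : ∀ {k D} → IsDominationNumber (CAdj G) k →
                             Unique D → VertexCover D → DominatingInComplement D → k ≤ length D
  domination-number≤length {k} {D} (_ , minimal) unique cover dom =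
    subst (k ≤_) (length-map inj₁ D)
      (minimal (map inj₁ D) (map⁺ inj₁-injective unique) (central-dominating cover dom))

  ¬NStar⇒non-neighbour : ∀ {S v} → v ∉ S → ¬ NStar G S v → ∃ λ a → a ∈ S × ¬ Edge G a v
  ¬NStar⇒non-neighbour {S} {v} v∉S ¬N
    with ¬∀⟶∃¬ n (λ y → y ∈ S → Edge G y v) (λ y → (y ∈? S) →-dec edge? y v) (λ all → ¬N (v∉S , all))
  ... | y , ¬imp with y ∈? S
  ...   | yes y∈S = y , y∈S , λ e → ¬imp (λ _ → e)
  ...   | no  y∉S = contradiction (λ y∈S → contradiction y∈S y∉S) ¬imp

  module _ {A : Subset n} (bipartite : IsBipartition G A) where

    same-side⇒¬Edge : ∀ {a b} → a ∈ A → b ∈ A → ¬ Edge G a b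
    same-side⇒¬Edge a∈A b∈A e with bipartite _ _ e
    ... | inj₁ (_ , b∉A) = b∉A b∈A
    ... | inj₂ (a∉A , _) = a∉A a∈A

    endpoint-inside : ∀ u v → Edge G u v → u ∈ A ⊎ v ∈ A
    endpoint-inside u v e with bipartite u v e
    ... | inj₁ (u∈A , _) = inj₁ u∈A
    ... | inj₂ (_ , v∈A) = inj₂ v∈A

    endpoint-outside : ∀ u v → Edge G u v → u ∉ A ⊎ v ∉ A
    endpoint-outside u v e with bipartite u v e
    ... | inj₁ (_ , v∉A) = inj₂ v∉A
    ... | inj₂ (u∉A , _) = inj₁ u∉A

    domination-number≤1+∣B∣ : ∀ {k} → 0 < ∣ A ∣ → IsDominationNumber (CAdj G) k → k ≤ suc ∣ ∁ A ∣
    domination-number≤1+∣B∣ {k} 0<∣A∣ γ with 0<∣p∣⇒nonempty A 0<∣A∣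
    ... | a₀ , a₀∈A = subst (k ≤_) (cong suc (length-elements (∁ A)))
                        (domination-number≤length γ unique cover dom)
      where
      in-B : ∀ {u} → u ∉ A → u ∈ₗ a₀ ∷ₗ elements (∁ A)
      in-B u∉A = there (∈-elements⁺ (x∉p⇒x∈∁p u∉A))

      unique : Unique (a₀ ∷ₗ elements (∁ A))
      unique = ¬Any⇒All¬ _ (λ a₀∈B → x∈∁p⇒x∉p (∈-elements⁻ (∁ A) a₀∈B) a₀∈A)
             ∷ elements-unique (∁ A)

      cover : VertexCover (a₀ ∷ₗ elements (∁ A))
      cover u v e with endpoint-outside u v e
      ... | inj₁ u∉A = inj₁ (in-B u∉A)
      ... | inj₂ v∉A = inj₂ (in-B v∉A)

      dom : DominatingInComplement (a₀ ∷ₗ elements (∁ A))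
      dom v v∉D with v ∈? A
      ... | yes v∈A = a₀ , here refl , same-side⇒¬Edge a₀∈A v∈A
      ... | no  v∉A = contradiction (in-B v∉A) v∉D

    domination-number≤∣A∣ : ∀ {k} → ¬ (∃ λ b → b ∈ ∁ A × NStar G A b) →
                            IsDominationNumber (CAdj G) k → k ≤ ∣ A ∣
    domination-number≤∣A∣ {k} ∄b γ = subst (k ≤_) (length-elements A)
                                       (domination-number≤length γ (elements-unique A) cover dom)
      where
      cover : VertexCover (elements A)
      cover u v e with endpoint-inside u v e
      ... | inj₁ u∈A = inj₁ (∈-elements⁺ u∈A)
      ... | inj₂ v∈A = inj₂ (∈-elements⁺ v∈A)

      dom : DominatingInComplement (elements A)
      dom v v∉D =
        let a , a∈A , ¬e = ¬NStar⇒non-neighbour v∉A (λ N → ∄b (v , x∉p⇒x∈∁p v∉A , N))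
        in  a , ∈-elements⁺ a∈A , ¬e
        where
        v∉A : v ∉ A
        v∉A v∈A = v∉D (∈-elements⁺ v∈A)

corollary2p7 : ∀ {n} (G : Graph n) (A : Subset n)
    → IsBipartition G A
    → 1 ≤ ∣ A ∣ → ∣ A ∣ ≤ ∣ ∁ A ∣
    → (∃₂ λ u v → Edge G u v)
    → ∀ k → IsDominationNumber (CAdj G) k
    → k ≤ suc ∣ ∁ A ∣ × (k ≡ suc ∣ ∁ A ∣ → ∃ λ b → b ∈ ∁ A × NStar G A b)
corollary2p7 G A bipartite 0<∣A∣ ∣A∣≤∣B∣ _ k γ =
  domination-number≤1+∣B∣ G bipartite 0<∣A∣ γ , equality
  where
  equality : k ≡ suc ∣ ∁ A ∣ → ∃ λ b → b ∈ ∁ A × NStar G A b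
  equality k≡1+∣B∣ with any? (λ b → (b ∈? ∁ A) ×-dec NStar? G A b)
  ... | yes b = b
  ... | no ∄b = contradiction
                  (subst (_≤ ∣ ∁ A ∣) k≡1+∣B∣ (≤-trans (domination-number≤∣A∣ G bipartite ∄b γ) ∣A∣≤∣B∣))
                  (n≮n ∣ ∁ A ∣)
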